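{- Let $N$ be a positive integer and for each integer $n\ge 0$ let $$a_n^N=\sum_{\substack{p_1+\cdots+p_N=n\\ p_i\in\mathbb{Z}_{\ge 0}}}\left(\frac{n!}{p_1!\,p_2!\cdots p_N!}\right)^2 .$$ For each integer $k\ge 0$ let $S_k(N)$ be the set of sequences $(\alpha_1,\dots,\alpha_k)$ of positive integers with $\alpha_1\le N$ and $\alpha_{i+1}\le \alpha_i-2$ for $1\le i<k$ (so $S_0(N)$ consists only of the empty sequence), and put $\beta_i=N+1-\alpha_i$. Define $$c_k(n)=n^{N+1}\sum_{(\alpha_1,\dots,\alpha_k)\in S_k(N)}\ \prod_{i=1}^k\left(-\alpha_i\beta_i\left(\frac{n-i}{n-i+1}\right)^{\alpha_i-1}\right),$$ where an empty product equals $1$ (and $c_k(n)=0$ when $S_k(N)$ is empty, which is the case for $k>\lfloor (N+1)/2\rfloor$). Then for every integer $n\ge \max(1,\lfloor (N+1)/2\rfloor)$, $$\sum_{k=0}^{\lfloor (N+1)/2\rfloor} c_k(n)\,a_{n-k}^N=0 .$$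
   Context: The coefficients $c_k(n)$ are polynomials in $n$. For $N=2$ this gives $n^3a_n^2-2n^2(2n-1)a_{n-1}^2=0$, and for $N=3$ it gives $n^4a^3_n-n^2(10n^2-10n+3)a^3_{n-1}+9n^2(n-1)^2a^3_{n-2}=0$. -}

module Defs where

open import Data.Nat as ℕ using (ℕ; zero; suc; _!; _≤ᵇ_; _≡ᵇ_; _∸_; NonZero; ⌊_/2⌋)
open import Data.Nat.Properties using (_!≢0; m*n≢0)
open import Data.Bool using (Bool; true; false; _∧_)
open import Data.List using (List; []; _∷_; map; concatMap; filter; upTo; foldr)
open import Data.Integer using (+_)
open import Data.Rational using (ℚ; 0ℚ; 1ℚ; _+_; _*_; -_; _/_)
open import Relation.Nullary.Decidable using (does)
open import Data.Bool.Properties using (T?)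

sumℚ : List ℚ → ℚ
sumℚ = foldr _+_ 0ℚ

powℚ : ℚ → ℕ → ℚ
powℚ x zero = 1ℚ
powℚ x (suc m) = x * powℚ x m

lists : ℕ → List ℕ → List (List ℕ)
lists zero xs = [] ∷ []
lists (suc k) xs = concatMap (λ x → map (x ∷_) (lists k xs)) xs

sumℕ : List ℕ → ℕ
sumℕ = foldr ℕ._+_ 0

compositions : ℕ → ℕ → List (List ℕ)
compositions N n = filter (λ ps → T? (sumℕ ps ≡ᵇ n)) (lists N (upTo (suc n)))

prodFact : List ℕ → ℕ
prodFact [] = 1
prodFact (p ∷ ps) = p ! ℕ.* prodFact ps

prodFact≢0 : ∀ ps → NonZero (prodFact ps)
prodFact≢0 [] = _
prodFact≢0 (p ∷ ps) = m*n≢0 (p !) (prodFact ps) {{p !≢0}} {{prodFact≢0 ps}}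

multinomial : ℕ → List ℕ → ℚ
multinomial n ps = (+ (n !) / prodFact ps) {{prodFact≢0 ps}}

a : ℕ → ℕ → ℚ
a N n = sumℚ (map (λ ps → multinomial n ps * multinomial n ps) (compositions N n))

allPos : List ℕ → Bool
allPos [] = true
allPos (x ∷ xs) = (1 ≤ᵇ x) ∧ allPos xs

gapOK : List ℕ → Bool
gapOK [] = true
gapOK (x ∷ []) = true
gapOK (x ∷ y ∷ xs) = (suc (suc y) ≤ᵇ x) ∧ gapOK (y ∷ xs)

headOK : ℕ → List ℕ → Bool
headOK N [] = true
headOK N (x ∷ xs) = x ≤ᵇ N

inS : ℕ → List ℕ → Bool
inS N αs = allPos αs ∧ headOK N αs ∧ gapOK αs

-- S_k(N), enumerated among length-k lists with entries in {0,…,N}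
-- (every element of S_k(N) has all entries ≤ α₁ ≤ N)
S : ℕ → ℕ → List (List ℕ)
S N k = filter (λ αs → T? (inS N αs)) (lists k (upTo (suc N)))

factor : ℕ → ℕ → ℕ → ℕ → ℚ
factor N n i α =
  (- (+ (α ℕ.* (suc N ∸ α)) / 1)) * powℚ (+ (n ∸ i) / suc (n ∸ i)) (α ∸ 1)

prodFactors : ℕ → ℕ → ℕ → List ℕ → ℚ
prodFactors N n i [] = 1ℚ
prodFactors N n i (α ∷ αs) = factor N n i α * prodFactors N n (suc i) αs

c : ℕ → ℕ → ℕ → ℚ
c N k n = (+ (n ℕ.^ suc N) / 1) * sumℚ (map (prodFactors N n 1) (S N k))

M : ℕ → ℕ
M N = ⌊ suc N /2⌋

module Submission where

-- With w x = 1/(x!)², the multinomial sum gives a_n = (n!)² (w^{⋆N})_n for the Cauchy product ⋆.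
-- Let W = ∑ w x zˣ, θ = z d/dz and let E N j be the coefficients of (N choose j) W^{N-j} (θW)^j.
-- Since θ²W = zW, the Leibniz rule gives  n E_{j+1}(n) = (j+2) E_{j+2}(n) + (N-j) E_j(n-1).
-- Dividing the sum of the theorem by n^{N+1} and keeping only the sequences with α₁ ≤ j gives R_j(n);
-- splitting off the terms with the largest α₁ shows that R_j obeys the matching recursion, so by a
-- two-step induction on j,  n^j R_{j-1}(n) = j! (n!)² E_j(n).
-- For j = N + 1 the left side is the sum of the theorem and the right side vanishes, as E_{N+1} = 0.

open import Data.Bool using (Bool; true; false; if_then_else_; _∧_)
open import Data.Bool.Properties using (T?; ∧-zeroʳ)
open import Data.Integer using () renaming (+_ to pos)
import Data.Integer as ℤ
import Data.Integer.Properties as ℤₚ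
open import Data.List using (List; []; _∷_; map; concatMap; filter; upTo; applyUpTo; _++_)
open import Data.List.Properties using (map-++; map-∘)
open import Data.Nat as ℕ using (ℕ; zero; suc; _≤_; _<_; s≤s; z≤n; _∸_; _!; _≡ᵇ_; _<ᵇ_; NonZero; ⌊_/2⌋; _^_)
import Data.Nat.Properties as ℕₚ
import Data.Nat.Solver as ℕSolver
open import Data.Rational using (ℚ; 0ℚ; 1ℚ; _+_; _*_; _-_; -_; _/_)
open import Data.Rational.Properties
  using (toℚᵘ-injective; toℚᵘ-fromℚᵘ; fromℚᵘ-cong; toℚᵘ-homo-*; toℚᵘ-homo-+;
         +-identityˡ; +-identityʳ; +-assoc; *-zeroˡ; *-zeroʳ; *-identityˡ; *-assoc; *-distribˡ-+)
import Data.Rational.Unnormalised as ℚᵘ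
import Data.Rational.Unnormalised.Properties as ℚᵘ
import Data.Rational.Solver as ℚSolver
open import Function using (_∘_; id)
open import Relation.Binary.PropositionalEquality
open ≡-Reasoning

open import Defs

open ℚSolver.+-*-Solver using (solve; _:+_; _:*_; _:-_; :-_; _:=_; con)
open ℕSolver.+-*-Solver using () renaming (solve to ℕsolve; _:*_ to _:×_; _:=_ to _:≡_; con to ℕcon)

ι : ℕ → ℚ
ι n = pos n / 1

/-≡ : ∀ a b c d .{{_ : NonZero b}} .{{_ : NonZero d}} →
      a ℕ.* d ≡ c ℕ.* b → pos a / b ≡ pos c / d
/-≡ a zero    c d       {{()}}
/-≡ a (suc b) c zero    {{_}} {{()}}
/-≡ a (suc b) c (suc d) ad≡cb = fromℚᵘ-cong {ℚᵘ.mkℚᵘ (pos a) b} {ℚᵘ.mkℚᵘ (pos c) d} (ℚᵘ.*≡* (begin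
  pos a ℤ.* pos (suc d) ≡⟨ ℤₚ.pos-* a (suc d) ⟨
  pos (a ℕ.* suc d) ≡⟨ cong pos ad≡cb ⟩
  pos (c ℕ.* suc b) ≡⟨ ℤₚ.pos-* c (suc b) ⟩
  pos c ℤ.* pos (suc b) ∎))

/-*-/ : ∀ a b c d .{{_ : NonZero b}} .{{_ : NonZero d}} →
        (pos a / b) * (pos c / d) ≡ (pos (a ℕ.* c) / (b ℕ.* d)) {{ℕₚ.m*n≢0 b d}}
/-*-/ a zero    c d       {{()}}
/-*-/ a (suc b) c zero    {{_}} {{()}}
/-*-/ a (suc b) c (suc d) = toℚᵘ-injective
  (ℚᵘ.≃-trans (toℚᵘ-homo-* (pos a / suc b) (pos c / suc d))
  (ℚᵘ.≃-trans (ℚᵘ.*-cong (toℚᵘ-fromℚᵘ (ℚᵘ.mkℚᵘ (pos a) b)) (toℚᵘ-fromℚᵘ (ℚᵘ.mkℚᵘ (pos c) d)))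
  (ℚᵘ.≃-trans (ℚᵘ.*≡* (cong (ℤ._* pos (suc b ℕ.* suc d)) (sym (ℤₚ.pos-* a c))))
              (ℚᵘ.≃-sym (toℚᵘ-fromℚᵘ (ℚᵘ.mkℚᵘ (pos (a ℕ.* c)) (ℕ.pred (suc b ℕ.* suc d))))))))

ι-* : ∀ m n → ι (m ℕ.* n) ≡ ι m * ι n
ι-* m n = sym (/-*-/ m 1 n 1)

ι-+ : ∀ m n → ι (m ℕ.+ n) ≡ ι m + ι n
ι-+ m n = toℚᵘ-injective
  (ℚᵘ.≃-trans (toℚᵘ-fromℚᵘ (ℚᵘ.mkℚᵘ (pos (m ℕ.+ n)) 0))
  (ℚᵘ.≃-trans (ℚᵘ.*≡* pos-+-cross)
  (ℚᵘ.≃-sym (ℚᵘ.≃-trans (toℚᵘ-homo-+ (ι m) (ι n))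
                         (ℚᵘ.+-cong (toℚᵘ-fromℚᵘ (ℚᵘ.mkℚᵘ (pos m) 0)) (toℚᵘ-fromℚᵘ (ℚᵘ.mkℚᵘ (pos n) 0)))))))
  where
  pos-+-cross : pos (m ℕ.+ n) ℤ.* pos 1 ≡ (pos m ℤ.* pos 1 ℤ.+ pos n ℤ.* pos 1) ℤ.* pos 1
  pos-+-cross = begin
    pos (m ℕ.+ n) ℤ.* pos 1                     ≡⟨ ℤₚ.*-identityʳ _ ⟩
    pos (m ℕ.+ n)                               ≡⟨ ℤₚ.pos-+ m n ⟩
    pos m ℤ.+ pos n                             ≡⟨ cong₂ ℤ._+_ (ℤₚ.*-identityʳ (pos m)) (ℤₚ.*-identityʳ (pos n)) ⟨
    pos m ℤ.* pos 1 ℤ.+ pos n ℤ.* pos 1         ≡⟨ ℤₚ.*-identityʳ _ ⟨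
    (pos m ℤ.* pos 1 ℤ.+ pos n ℤ.* pos 1) ℤ.* pos 1 ∎

ι-*-/ : ∀ a c d .{{_ : NonZero d}} → ι a * (pos c / d) ≡ pos (a ℕ.* c) / d
ι-*-/ a c d = trans (/-*-/ a 1 c d) (/-≡ (a ℕ.* c) (1 ℕ.* d) (a ℕ.* c) d {{ℕₚ.m*n≢0 1 d}}
  (cong ((a ℕ.* c) ℕ.*_) (sym (ℕₚ.*-identityˡ d))))

ι-∸ : ∀ {m n} → n ≤ m → ι (m ∸ n) ≡ ι m - ι n
ι-∸ {m} {n} n≤m = begin
  ι (m ∸ n)                ≡⟨ solve 2 (λ x y → x := (x :+ y) :- y) refl (ι (m ∸ n)) (ι n) ⟩
  (ι (m ∸ n) + ι n) - ι n  ≡⟨ cong (_- ι n) (sym (ι-+ (m ∸ n) n)) ⟩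
  ι (m ∸ n ℕ.+ n) - ι n    ≡⟨ cong (λ k → ι k - ι n) (ℕₚ.m∸n+n≡m n≤m) ⟩
  ι m - ι n                ∎

ι-suc : ∀ n → ι (suc n) ≡ 1ℚ + ι n
ι-suc = ι-+ 1

powℚ-* : ∀ x y k → powℚ x k * powℚ y k ≡ powℚ (x * y) k
powℚ-* x y zero    = *-identityˡ 1ℚ
powℚ-* x y (suc k) = begin
  (x * powℚ x k) * (y * powℚ y k)   ≡⟨ solve 4 (λ x y p q → (x :* p) :* (y :* q) := (x :* y) :* (p :* q)) refl x y (powℚ x k) (powℚ y k) ⟩
  (x * y) * (powℚ x k * powℚ y k)   ≡⟨ cong ((x * y) *_) (powℚ-* x y k) ⟩
  (x * y) * powℚ (x * y) k          ∎

ι-^ : ∀ n k → ι (n ^ k) ≡ powℚ (ι n) k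
ι-^ n zero    = refl
ι-^ n (suc k) = trans (ι-* n (n ^ k)) (cong (ι n *_) (ι-^ n k))

pow-ratio : ∀ m j → powℚ (ι (suc m)) j * powℚ (pos m / suc m) j ≡ powℚ (ι m) j
pow-ratio m j = trans (powℚ-* (ι (suc m)) (pos m / suc m) j)
  (cong (λ z → powℚ z j) (trans (ι-*-/ (suc m) m (suc m))
    (/-≡ (suc m ℕ.* m) (suc m) m 1 (ℕsolve 2 (λ s m → (s :× m) :× ℕcon 1 :≡ m :× s) refl (suc m) m))))

-- Finite sums

∑< : ℕ → (ℕ → ℚ) → ℚ
∑< zero    f = 0ℚ
∑< (suc n) f = f 0 + ∑< n (f ∘ suc)

syntax ∑< n (λ x → e) = ∑[ x < n ] e

∑<-cong : ∀ n {f g : ℕ → ℚ} → (∀ {x} → x < n → f x ≡ g x) → ∑< n f ≡ ∑< n g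
∑<-cong zero    f≡g = refl
∑<-cong (suc n) f≡g = cong₂ _+_ (f≡g (s≤s z≤n)) (∑<-cong n (f≡g ∘ s≤s))

∑<-zero : ∀ n → ∑[ x < n ] 0ℚ ≡ 0ℚ
∑<-zero zero    = refl
∑<-zero (suc n) = trans (+-identityˡ _) (∑<-zero n)

∑<-+ : ∀ n (f g : ℕ → ℚ) → ∑[ x < n ] (f x + g x) ≡ ∑< n f + ∑< n g
∑<-+ zero    f g = sym (+-identityˡ 0ℚ)
∑<-+ (suc n) f g = trans (cong ((f 0 + g 0) +_) (∑<-+ n (f ∘ suc) (g ∘ suc)))
  (solve 4 (λ a b c d → (a :+ b) :+ (c :+ d) := (a :+ c) :+ (b :+ d)) refl (f 0) (g 0) _ _)

∑<-*ˡ : ∀ n c (f : ℕ → ℚ) → ∑[ x < n ] (c * f x) ≡ c * ∑< n f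
∑<-*ˡ zero    c f = sym (*-zeroʳ c)
∑<-*ˡ (suc n) c f = trans (cong (c * f 0 +_) (∑<-*ˡ n c (f ∘ suc))) (sym (*-distribˡ-+ c _ _))

∑<-last : ∀ n (f : ℕ → ℚ) → ∑< (suc n) f ≡ ∑< n f + f n
∑<-last zero    f = trans (+-identityʳ (f 0)) (sym (+-identityˡ (f 0)))
∑<-last (suc n) f = trans (cong (f 0 +_) (∑<-last n (f ∘ suc))) (sym (+-assoc (f 0) _ _))

∑<-<ᵇ : ∀ {j n} (f : ℕ → ℚ) → j ≤ n → ∑[ x < n ] (if x <ᵇ j then f x else 0ℚ) ≡ ∑< j f
∑<-<ᵇ {zero}  {n}     f z≤n       = ∑<-zero n
∑<-<ᵇ {suc j} {suc n} f (s≤s j≤n) = cong (f 0 +_) (∑<-<ᵇ (f ∘ suc) j≤n)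

sumℚ-cong : ∀ {A : Set} {f g : A → ℚ} xs → (∀ x → f x ≡ g x) → sumℚ (map f xs) ≡ sumℚ (map g xs)
sumℚ-cong []       f≡g = refl
sumℚ-cong (x ∷ xs) f≡g = cong₂ _+_ (f≡g x) (sumℚ-cong xs f≡g)

sumℚ-zero : ∀ {A : Set} (xs : List A) → sumℚ (map (λ _ → 0ℚ) xs) ≡ 0ℚ
sumℚ-zero []       = refl
sumℚ-zero (x ∷ xs) = trans (+-identityˡ _) (sumℚ-zero xs)

sumℚ-*ˡ : ∀ {A : Set} c (f : A → ℚ) xs → sumℚ (map (λ x → c * f x) xs) ≡ c * sumℚ (map f xs)
sumℚ-*ˡ c f []       = sym (*-zeroʳ c)
sumℚ-*ˡ c f (x ∷ xs) = trans (cong (c * f x +_) (sumℚ-*ˡ c f xs)) (sym (*-distribˡ-+ c _ _))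

sumℚ-++ : ∀ xs ys → sumℚ (xs ++ ys) ≡ sumℚ xs + sumℚ ys
sumℚ-++ []       ys = sym (+-identityˡ _)
sumℚ-++ (x ∷ xs) ys = trans (cong (x +_) (sumℚ-++ xs ys)) (sym (+-assoc x _ _))

sumℚ-concatMap : ∀ {A B : Set} (f : B → ℚ) (g : A → List B) xs →
  sumℚ (map f (concatMap g xs)) ≡ sumℚ (map (λ x → sumℚ (map f (g x))) xs)
sumℚ-concatMap f g []       = refl
sumℚ-concatMap f g (x ∷ xs) = begin
  sumℚ (map f (g x ++ concatMap g xs))           ≡⟨ cong sumℚ (map-++ f (g x) (concatMap g xs)) ⟩
  sumℚ (map f (g x) ++ map f (concatMap g xs))   ≡⟨ sumℚ-++ (map f (g x)) _ ⟩
  sumℚ (map f (g x)) + sumℚ (map f (concatMap g xs)) ≡⟨ cong (sumℚ (map f (g x)) +_) (sumℚ-concatMap f g xs) ⟩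
  sumℚ (map f (g x)) + sumℚ (map (λ x → sumℚ (map f (g x))) xs) ∎

sumℚ-lists-suc : ∀ k xs (f : List ℕ → ℚ) →
  sumℚ (map f (lists (suc k) xs)) ≡ sumℚ (map (λ x → sumℚ (map (λ ys → f (x ∷ ys)) (lists k xs))) xs)
sumℚ-lists-suc k xs f = trans (sumℚ-concatMap f (λ x → map (x ∷_) (lists k xs)) xs)
  (sumℚ-cong xs (λ x → cong sumℚ (sym (map-∘ (lists k xs)))))

sumℚ-upTo : ∀ n (f : ℕ → ℚ) → sumℚ (map f (upTo n)) ≡ ∑< n f
sumℚ-upTo n f = applyUpTo-∑< n f id
  where
  applyUpTo-∑< : ∀ n (f : ℕ → ℚ) g → sumℚ (map f (applyUpTo g n)) ≡ ∑< n (f ∘ g)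
  applyUpTo-∑< zero    f g = refl
  applyUpTo-∑< (suc n) f g = cong (f (g 0) +_) (applyUpTo-∑< n f (g ∘ suc))

sumℚ-filter : ∀ {A : Set} (p : A → Bool) (f : A → ℚ) xs →
  sumℚ (map f (filter (λ x → T? (p x)) xs)) ≡ sumℚ (map (λ x → if p x then f x else 0ℚ) xs)
sumℚ-filter p f [] = refl
sumℚ-filter p f (x ∷ xs) with p x
... | true  = cong (f x +_) (sumℚ-filter p f xs)
... | false = trans (sumℚ-filter p f xs) (sym (+-identityˡ _))

sumℚ-if-∧ : ∀ {A : Set} b (p : A → Bool) c (f : A → ℚ) xs →
  sumℚ (map (λ x → if b ∧ p x then c * f x else 0ℚ) xs) ≡
  (if b then c * sumℚ (map (λ x → if p x then f x else 0ℚ) xs) else 0ℚ)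
sumℚ-if-∧ false p c f xs = sumℚ-zero xs
sumℚ-if-∧ true  p c f xs =
  trans (sumℚ-cong xs (λ x → if-*ʳ (p x))) (sumℚ-*ˡ c (λ x → if p x then f x else 0ℚ) xs)
  where
  if-*ʳ : ∀ {y} b → (if b then c * y else 0ℚ) ≡ c * (if b then y else 0ℚ)
  if-*ʳ true  = refl
  if-*ʳ false = sym (*-zeroʳ c)

-- Cauchy products and the Euler operator θ

Seq : Set
Seq = ℕ → ℚ

0ˢ : Seq
0ˢ _ = 0ℚ

infixl 7 _⋆_

_⋆_ : Seq → Seq → Seq
(u ⋆ v) n = ∑[ x < suc n ] (u x * v (n ∸ x))

θ : Seq → Seq
θ u n = ι n * u n

shift : Seq → Seq
shift u zero    = 0ℚ
shift u (suc n) = u n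

shift-0ˢ : ∀ n → shift 0ˢ n ≡ 0ℚ
shift-0ˢ zero    = refl
shift-0ˢ (suc n) = refl

⋆-congˡ : ∀ {u u′} v → (∀ m → u m ≡ u′ m) → ∀ n → (u ⋆ v) n ≡ (u′ ⋆ v) n
⋆-congˡ v u≡u′ n = ∑<-cong (suc n) (λ {x} _ → cong (_* v (n ∸ x)) (u≡u′ x))

⋆-congʳ : ∀ u {v v′} → (∀ m → v m ≡ v′ m) → ∀ n → (u ⋆ v) n ≡ (u ⋆ v′) n
⋆-congʳ u v≡v′ n = ∑<-cong (suc n) (λ {x} _ → cong (u x *_) (v≡v′ (n ∸ x)))

⋆-zeroʳ : ∀ u n → (u ⋆ 0ˢ) n ≡ 0ℚ
⋆-zeroʳ u n = trans (∑<-cong (suc n) (λ {x} _ → *-zeroʳ (u x))) (∑<-zero (suc n))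

⋆-+ʳ : ∀ u v v′ n → (u ⋆ (λ m → v m + v′ m)) n ≡ (u ⋆ v) n + (u ⋆ v′) n
⋆-+ʳ u v v′ n = trans (∑<-cong (suc n) (λ {x} _ → *-distribˡ-+ (u x) (v (n ∸ x)) (v′ (n ∸ x))))
                      (∑<-+ (suc n) (λ x → u x * v (n ∸ x)) (λ x → u x * v′ (n ∸ x)))

⋆-*ʳ : ∀ u c v n → (u ⋆ (λ m → c * v m)) n ≡ c * (u ⋆ v) n
⋆-*ʳ u c v n = trans (∑<-cong (suc n) (λ {x} _ → swap (u x) (v (n ∸ x)))) (∑<-*ˡ (suc n) c (λ x → u x * v (n ∸ x)))
  where
  swap : ∀ a b → a * (c * b) ≡ c * (a * b)
  swap a b = solve 3 (λ a c b → a :* (c :* b) := c :* (a :* b)) refl a c b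

⋆-shiftˡ : ∀ u v n → (shift u ⋆ v) n ≡ shift (u ⋆ v) n
⋆-shiftˡ u v zero    = trans (+-identityʳ _) (*-zeroˡ (v 0))
⋆-shiftˡ u v (suc n) = trans (cong (_+ (u ⋆ v) n) (*-zeroˡ (v (suc n)))) (+-identityˡ _)

⋆-shiftʳ : ∀ u v n → (u ⋆ shift v) n ≡ shift (u ⋆ v) n
⋆-shiftʳ u v zero          = trans (+-identityʳ _) (*-zeroʳ (u 0))
⋆-shiftʳ u v (suc zero)    = cong (u 0 * v 0 +_) (⋆-shiftʳ (u ∘ suc) v 0)
⋆-shiftʳ u v (suc (suc n)) = cong (u 0 * v (suc n) +_) (⋆-shiftʳ (u ∘ suc) v (suc n))

⋆-recurrence : ∀ u {f g h : Seq} a b → (∀ m → f m ≡ a * g m + b * shift h m) →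
               ∀ n → (u ⋆ f) n ≡ a * (u ⋆ g) n + b * shift (u ⋆ h) n
⋆-recurrence u {f} {g} {h} a b f≡ n = begin
  (u ⋆ f) n                                             ≡⟨ ⋆-congʳ u f≡ n ⟩
  (u ⋆ (λ m → a * g m + b * shift h m)) n              ≡⟨ ⋆-+ʳ u (λ m → a * g m) (λ m → b * shift h m) n ⟩
  (u ⋆ (λ m → a * g m)) n + (u ⋆ (λ m → b * shift h m)) n
    ≡⟨ cong₂ _+_ (⋆-*ʳ u a g n) (trans (⋆-*ʳ u b (shift h) n) (cong (b *_) (⋆-shiftʳ u h n))) ⟩
  a * (u ⋆ g) n + b * shift (u ⋆ h) n                   ∎

-- Leibniz rule: split the weight n = x + (n - x) inside the Cauchy product.
θ-⋆ : ∀ u v n → θ (u ⋆ v) n ≡ (θ u ⋆ v) n + (u ⋆ θ v) n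
θ-⋆ u v n = begin
  ι n * (u ⋆ v) n                                      ≡⟨ ∑<-*ˡ (suc n) (ι n) (λ x → u x * v (n ∸ x)) ⟨
  ∑[ x < suc n ] (ι n * (u x * v (n ∸ x)))             ≡⟨ ∑<-cong (suc n) (λ x<1+n → split (ℕₚ.m<1+n⇒m≤n x<1+n)) ⟩
  ∑[ x < suc n ] ((ι x * u x) * v (n ∸ x) + u x * (ι (n ∸ x) * v (n ∸ x)))
    ≡⟨ ∑<-+ (suc n) (λ x → (ι x * u x) * v (n ∸ x)) (λ x → u x * (ι (n ∸ x) * v (n ∸ x))) ⟩
  (θ u ⋆ v) n + (u ⋆ θ v) n                            ∎
  where
  split : ∀ {x} → x ≤ n → ι n * (u x * v (n ∸ x)) ≡ (ι x * u x) * v (n ∸ x) + u x * (ι (n ∸ x) * v (n ∸ x))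
  split {x} x≤n = begin
    ι n * (u x * v (n ∸ x))                 ≡⟨ cong (λ k → ι k * (u x * v (n ∸ x))) (ℕₚ.m+[n∸m]≡n x≤n) ⟨
    ι (x ℕ.+ (n ∸ x)) * (u x * v (n ∸ x))   ≡⟨ cong (_* (u x * v (n ∸ x))) (ι-+ x (n ∸ x)) ⟩
    (ι x + ι (n ∸ x)) * (u x * v (n ∸ x))   ≡⟨ solve 4 (λ p q a b → (p :+ q) :* (a :* b) := (p :* a) :* b :+ a :* (q :* b)) refl (ι x) (ι (n ∸ x)) (u x) (v (n ∸ x)) ⟩
    (ι x * u x) * v (n ∸ x) + u x * (ι (n ∸ x) * v (n ∸ x)) ∎

-- The sequences E N j

fact²≢0 : ∀ n → NonZero (n ! ℕ.* n !)
fact²≢0 n = ℕₚ.m*n≢0 (n !) (n !) {{n ℕₚ.!≢0}} {{n ℕₚ.!≢0}}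

w : Seq
w x = (pos 1 / (x ! ℕ.* x !)) {{fact²≢0 x}}

θ²w≡shift-w : ∀ m → θ (θ w) m ≡ shift w m
θ²w≡shift-w zero    = refl
θ²w≡shift-w (suc m) = begin
  ι s * (ι s * w s)
    ≡⟨ cong (ι s *_) (ι-*-/ s 1 (s ! ℕ.* s !) {{fact²≢0 s}}) ⟩
  ι s * (pos (s ℕ.* 1) / (s ! ℕ.* s !)) {{fact²≢0 s}}
    ≡⟨ ι-*-/ s (s ℕ.* 1) (s ! ℕ.* s !) {{fact²≢0 s}} ⟩
  (pos (s ℕ.* (s ℕ.* 1)) / (s ! ℕ.* s !)) {{fact²≢0 s}}
    ≡⟨ /-≡ _ _ 1 (m ! ℕ.* m !) {{fact²≢0 s}} {{fact²≢0 m}} (s²f²≡[sf]² s (m !)) ⟩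
  w m ∎
  where
  s = suc m
  s²f²≡[sf]² : ∀ s f → (s ℕ.* (s ℕ.* 1)) ℕ.* (f ℕ.* f) ≡ 1 ℕ.* ((s ℕ.* f) ℕ.* (s ℕ.* f))
  s²f²≡[sf]² = ℕsolve 2 (λ s f → (s :× (s :× ℕcon 1)) :× (f :× f) :≡ ℕcon 1 :× ((s :× f) :× (s :× f))) refl

δ : Seq
δ zero    = 1ℚ
δ (suc _) = 0ℚ

prev : (ℕ → Seq) → ℕ → Seq
prev F zero    = 0ˢ
prev F (suc j) = F j

-- E N j n is the coefficient of zⁿ in (N choose j) W^(N-j) (θW)^j; the recursion in N comes from
-- (W + t θW)^(N+1) = (W + t θW) (W + t θW)^N.
E : ℕ → ℕ → Seq
E zero    zero    = δ
E zero    (suc j) = 0ˢ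
E (suc N) j n     = (w ⋆ E N j) n + (θ w ⋆ prev (E N) j) n

κ : ℕ → ℕ → ℚ
κ N j = ι (suc N) - ι j

Recurrence : ℕ → (ℕ → Seq) → Set
Recurrence N F = ∀ j m → θ (F j) m ≡ ι (suc j) * F (suc j) m + κ N j * shift (prev F j) m

κ-suc : ∀ N j → κ (suc N) j ≡ 1ℚ + κ N j
κ-suc N j = trans (cong (_- ι j) (ι-suc (suc N)))
                  (solve 2 (λ a b → (con 1ℚ :+ a) :- b := con 1ℚ :+ (a :- b)) refl (ι (suc N)) (ι j))

κ-suc-suc : ∀ N j → κ (suc N) (suc j) ≡ κ N j
κ-suc-suc N j = begin
  ι (suc (suc N)) - ι (suc j)        ≡⟨ cong₂ _-_ (ι-suc (suc N)) (ι-suc j) ⟩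
  (1ℚ + ι (suc N)) - (1ℚ + ι j)      ≡⟨ solve 2 (λ a b → (con 1ℚ :+ a) :- (con 1ℚ :+ b) := a :- b) refl (ι (suc N)) (ι j) ⟩
  ι (suc N) - ι j                    ∎

θ-prev : ∀ {N F} → Recurrence N F →
         ∀ j m → θ (prev F j) m ≡ ι j * F j m + κ (suc N) j * shift (prev (prev F) j) m
θ-prev {N} {F} rec zero m = begin
  ι m * 0ℚ                                  ≡⟨ *-zeroʳ (ι m) ⟩
  0ℚ                                        ≡⟨ solve 2 (λ x k → con 0ℚ := con 0ℚ :* x :+ k :* con 0ℚ) refl (F 0 m) (κ (suc N) 0) ⟩
  ι 0 * F 0 m + κ (suc N) 0 * 0ℚ            ≡⟨ cong (λ z → ι 0 * F 0 m + κ (suc N) 0 * z) (shift-0ˢ m) ⟨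
  ι 0 * F 0 m + κ (suc N) 0 * shift 0ˢ m    ∎
θ-prev {N} {F} rec (suc j) m =
  trans (rec j m) (cong (λ k → ι (suc j) * F (suc j) m + k * shift (prev F j) m) (sym (κ-suc-suc N j)))

shift-prev-E-suc : ∀ N j n →
  shift (prev (E (suc N)) j) n ≡ shift (w ⋆ prev (E N) j) n + shift (θ w ⋆ prev (prev (E N)) j) n
shift-prev-E-suc N j zero          = sym (+-identityˡ 0ℚ)
shift-prev-E-suc N zero (suc n)    = sym (trans (cong₂ _+_ (⋆-zeroʳ w n) (⋆-zeroʳ (θ w) n)) (+-identityˡ 0ℚ))
shift-prev-E-suc N (suc j) (suc n) = refl

E-recurrence : ∀ N → Recurrence N (E N)
E-recurrence zero zero zero                = refl
E-recurrence zero zero (suc m)             = *-zeroʳ (ι (suc m))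
E-recurrence zero (suc zero) m             = trans (*-zeroʳ (ι m)) (sym (trans (+-identityˡ _) (*-zeroˡ (shift δ m))))
E-recurrence zero (suc (suc j)) m          = begin
  ι m * 0ℚ                                              ≡⟨ *-zeroʳ (ι m) ⟩
  0ℚ                                                    ≡⟨ solve 2 (λ x k → con 0ℚ := x :* con 0ℚ :+ k :* con 0ℚ) refl (ι (3 ℕ.+ j)) (κ 0 (2 ℕ.+ j)) ⟩
  ι (3 ℕ.+ j) * 0ℚ + κ 0 (2 ℕ.+ j) * 0ℚ                 ≡⟨ cong (λ z → ι (3 ℕ.+ j) * 0ℚ + κ 0 (2 ℕ.+ j) * z) (shift-0ˢ m) ⟨
  ι (3 ℕ.+ j) * 0ℚ + κ 0 (2 ℕ.+ j) * shift 0ˢ m         ∎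
E-recurrence (suc N) j n = begin
  ι n * ((w ⋆ E N j) n + (θ w ⋆ P j) n)
    ≡⟨ *-distribˡ-+ (ι n) _ _ ⟩
  θ (w ⋆ E N j) n + θ (θ w ⋆ P j) n
    ≡⟨ cong₂ _+_ (θ-⋆ w (E N j) n) (θ-⋆ (θ w) (P j) n) ⟩
  ((θ w ⋆ E N j) n + (w ⋆ θ (E N j)) n) + ((θ (θ w) ⋆ P j) n + (θ w ⋆ θ (P j)) n)
    ≡⟨ cong₂ (λ p q → (A + p) + q) w⋆θE (cong₂ _+_ θ²w⋆P θw⋆θP) ⟩
  (A + (ι (suc j) * B + κ N j * C)) + (C + (ι j * A + κ (suc N) j * D))
    ≡⟨ cong₂ (λ p q → (A + (p * B + κ N j * C)) + (C + (ι j * A + q * D))) (ι-suc j) (κ-suc N j) ⟩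
  (A + ((1ℚ + ι j) * B + κ N j * C)) + (C + (ι j * A + (1ℚ + κ N j) * D))
    ≡⟨ solve 6 (λ a b c d i k → (a :+ ((con 1ℚ :+ i) :* b :+ k :* c)) :+ (c :+ (i :* a :+ (con 1ℚ :+ k) :* d))
                              := (con 1ℚ :+ i) :* (b :+ a) :+ (con 1ℚ :+ k) :* (c :+ d)) refl A B C D (ι j) (κ N j) ⟩
  (1ℚ + ι j) * (B + A) + (1ℚ + κ N j) * (C + D)
    ≡⟨ cong₂ (λ p q → p * (B + A) + q * (C + D)) (ι-suc j) (κ-suc N j) ⟨
  ι (suc j) * (B + A) + κ (suc N) j * (C + D)
    ≡⟨ cong (λ z → ι (suc j) * (B + A) + κ (suc N) j * z) (shift-prev-E-suc N j n) ⟨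
  ι (suc j) * E (suc N) (suc j) n + κ (suc N) j * shift (prev (E (suc N)) j) n ∎
  where
  P = prev (E N)
  A = (θ w ⋆ E N j) n
  B = (w ⋆ E N (suc j)) n
  C = shift (w ⋆ P j) n
  D = shift (θ w ⋆ prev P j) n
  w⋆θE : (w ⋆ θ (E N j)) n ≡ ι (suc j) * B + κ N j * C
  w⋆θE = ⋆-recurrence w {θ (E N j)} {E N (suc j)} {P j} (ι (suc j)) (κ N j) (E-recurrence N j) n
  θ²w⋆P : (θ (θ w) ⋆ P j) n ≡ C
  θ²w⋆P = trans (⋆-congˡ (P j) θ²w≡shift-w n) (⋆-shiftˡ w (P j) n)
  θw⋆θP : (θ w ⋆ θ (P j)) n ≡ ι j * A + κ (suc N) j * D
  θw⋆θP = ⋆-recurrence (θ w) {θ (P j)} {E N j} {prev P j} (ι j) (κ (suc N) j) (θ-prev {N} {E N} (E-recurrence N) j) n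

E-vanish : ∀ N j n → N < j → E N j n ≡ 0ℚ
E-vanish zero    (suc j)       n _               = refl
E-vanish (suc N) (suc (suc j)) n (s≤s (s≤s N≤j)) =
  trans (cong₂ _+_ (trans (⋆-congʳ w (λ m → E-vanish N (suc (suc j)) m (ℕₚ.m≤n⇒m≤1+n (s≤s N≤j))) n) (⋆-zeroʳ w n))
                   (trans (⋆-congʳ (θ w) (λ m → E-vanish N (suc j) m (s≤s N≤j)) n) (⋆-zeroʳ (θ w) n)))
        (+-identityˡ 0ℚ)

E-at-0 : ∀ N j → E N (suc j) 0 ≡ 0ℚ
E-at-0 zero    j = refl
E-at-0 (suc N) j = begin
  (w ⋆ E N (suc j)) 0 + (θ w ⋆ E N j) 0   ≡⟨ cong₂ _+_ (+-identityʳ (w 0 * E N (suc j) 0)) (+-identityʳ (θ w 0 * E N j 0)) ⟩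
  w 0 * E N (suc j) 0 + θ w 0 * E N j 0   ≡⟨ cong₂ _+_ (cong (w 0 *_) (E-at-0 N j)) (*-zeroˡ (E N j 0)) ⟩
  w 0 * 0ℚ + 0ℚ                           ≡⟨⟩
  0ℚ                                      ∎

E-three-term : ∀ N j m → suc j ≤ N →
  ι (suc m) * E N (suc j) (suc m) ≡ ι (suc (suc j)) * E N (suc (suc j)) (suc m) + ι (N ∸ j) * E N j m
E-three-term N j m j<N = trans (E-recurrence N (suc j) (suc m))
  (cong (λ k → ι (suc (suc j)) * E N (suc (suc j)) (suc m) + k * E N j m) (sym (ι-∸ {suc N} {suc j} (ℕₚ.m≤n⇒m≤1+n j<N))))

-- The sequence a

convPow : Seq → ℕ → Seq
convPow u zero    = δ
convPow u (suc N) = u ⋆ convPow u N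

E-zero≡convPow : ∀ N n → E N 0 n ≡ convPow w N n
E-zero≡convPow zero    n = refl
E-zero≡convPow (suc N) n =
  trans (cong₂ _+_ (⋆-congʳ w (E-zero≡convPow N) n) (⋆-zeroʳ (θ w) n)) (+-identityʳ _)

prodSeq : Seq → List ℕ → ℚ
prodSeq u []       = 1ℚ
prodSeq u (p ∷ ps) = u p * prodSeq u ps

+-≡ᵇ : ∀ x t s → (x ℕ.+ t ≡ᵇ s) ≡ (x <ᵇ suc s) ∧ (t ≡ᵇ s ∸ x)
+-≡ᵇ zero    t s       = refl
+-≡ᵇ (suc x) t zero    = refl
+-≡ᵇ (suc x) t (suc s) = +-≡ᵇ x t s

sumℚ-lists-convPow : ∀ u N {s m} → s ≤ m →
  sumℚ (map (λ ps → if sumℕ ps ≡ᵇ s then prodSeq u ps else 0ℚ) (lists N (upTo (suc m)))) ≡ convPow u N s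
sumℚ-lists-convPow u zero    {zero}  _ = +-identityʳ 1ℚ
sumℚ-lists-convPow u zero    {suc s} _ = +-identityʳ 0ℚ
sumℚ-lists-convPow u (suc N) {s} {m} s≤m = begin
  sumℚ (map F (lists (suc N) L))
    ≡⟨ sumℚ-lists-suc N L F ⟩
  sumℚ (map (λ x → sumℚ (map (λ ys → F (x ∷ ys)) (lists N L))) L)
    ≡⟨ sumℚ-cong L fixed-head ⟩
  sumℚ (map (λ x → if x <ᵇ suc s then u x * convPow u N (s ∸ x) else 0ℚ) L)
    ≡⟨ sumℚ-upTo (suc m) (λ x → if x <ᵇ suc s then u x * convPow u N (s ∸ x) else 0ℚ) ⟩
  ∑[ x < suc m ] (if x <ᵇ suc s then u x * convPow u N (s ∸ x) else 0ℚ)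
    ≡⟨ ∑<-<ᵇ (λ x → u x * convPow u N (s ∸ x)) (s≤s s≤m) ⟩
  (u ⋆ convPow u N) s ∎
  where
  L = upTo (suc m)
  F : List ℕ → ℚ
  F ps = if sumℕ ps ≡ᵇ s then prodSeq u ps else 0ℚ
  fixed-head : ∀ x → sumℚ (map (λ ys → F (x ∷ ys)) (lists N L)) ≡
                     (if x <ᵇ suc s then u x * convPow u N (s ∸ x) else 0ℚ)
  fixed-head x = begin
    sumℚ (map (λ ys → F (x ∷ ys)) (lists N L))
      ≡⟨ sumℚ-cong (lists N L) (λ ys → cong (λ b → if b then u x * prodSeq u ys else 0ℚ) (+-≡ᵇ x (sumℕ ys) s)) ⟩
    sumℚ (map (λ ys → if (x <ᵇ suc s) ∧ (sumℕ ys ≡ᵇ s ∸ x) then u x * prodSeq u ys else 0ℚ) (lists N L))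
      ≡⟨ sumℚ-if-∧ (x <ᵇ suc s) (λ ys → sumℕ ys ≡ᵇ s ∸ x) (u x) (prodSeq u) (lists N L) ⟩
    (if x <ᵇ suc s then u x * sumℚ (map (λ ys → if sumℕ ys ≡ᵇ s ∸ x then prodSeq u ys else 0ℚ) (lists N L)) else 0ℚ)
      ≡⟨ cong (λ z → if x <ᵇ suc s then u x * z else 0ℚ) (sumℚ-lists-convPow u N (ℕₚ.≤-trans (ℕₚ.m∸n≤m s x) s≤m)) ⟩
    (if x <ᵇ suc s then u x * convPow u N (s ∸ x) else 0ℚ) ∎

prodFact²≢0 : ∀ ps → NonZero (prodFact ps ℕ.* prodFact ps)
prodFact²≢0 ps = ℕₚ.m*n≢0 _ _ {{prodFact≢0 ps}} {{prodFact≢0 ps}}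

prodSeq-w : ∀ ps → prodSeq w ps ≡ (pos 1 / (prodFact ps ℕ.* prodFact ps)) {{prodFact²≢0 ps}}
prodSeq-w []       = refl
prodSeq-w (p ∷ ps) = begin
  w p * prodSeq w ps
    ≡⟨ cong (w p *_) (prodSeq-w ps) ⟩
  w p * (pos 1 / (P ℕ.* P)) {{prodFact²≢0 ps}}
    ≡⟨ /-*-/ 1 (p ! ℕ.* p !) 1 (P ℕ.* P) {{fact²≢0 p}} {{prodFact²≢0 ps}} ⟩
  (pos 1 / ((p ! ℕ.* p !) ℕ.* (P ℕ.* P))) {{ℕₚ.m*n≢0 _ _ {{fact²≢0 p}} {{prodFact²≢0 ps}}}}
    ≡⟨ /-≡ 1 _ 1 _ {{ℕₚ.m*n≢0 _ _ {{fact²≢0 p}} {{prodFact²≢0 ps}}}} {{prodFact²≢0 (p ∷ ps)}}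
           (ℕsolve 2 (λ f P → ℕcon 1 :× ((f :× P) :× (f :× P)) :≡ ℕcon 1 :× ((f :× f) :× (P :× P))) refl (p !) P) ⟩
  (pos 1 / (prodFact (p ∷ ps) ℕ.* prodFact (p ∷ ps))) {{prodFact²≢0 (p ∷ ps)}} ∎
  where P = prodFact ps

fact² : ℕ → ℚ
fact² n = ι (n !) * ι (n !)

fact²-suc : ∀ m → fact² (suc m) ≡ (ι (suc m) * ι (m !)) * (ι (suc m) * ι (m !))
fact²-suc m = cong₂ _*_ (ι-* (suc m) (m !)) (ι-* (suc m) (m !))

multinomial² : ∀ n ps → multinomial n ps * multinomial n ps ≡ fact² n * prodSeq w ps
multinomial² n ps = begin
  multinomial n ps * multinomial n ps
    ≡⟨ /-*-/ (n !) P (n !) P {{prodFact≢0 ps}} {{prodFact≢0 ps}} ⟩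
  (pos (n ! ℕ.* n !) / (P ℕ.* P)) {{prodFact²≢0 ps}}
    ≡⟨ /-≡ ((n ! ℕ.* n !) ℕ.* 1) (P ℕ.* P) (n ! ℕ.* n !) (P ℕ.* P) {{prodFact²≢0 ps}} {{prodFact²≢0 ps}}
           (cong (ℕ._* (P ℕ.* P)) (ℕₚ.*-identityʳ (n ! ℕ.* n !))) ⟨
  (pos ((n ! ℕ.* n !) ℕ.* 1) / (P ℕ.* P)) {{prodFact²≢0 ps}}
    ≡⟨ ι-*-/ (n ! ℕ.* n !) 1 (P ℕ.* P) {{prodFact²≢0 ps}} ⟨
  ι (n ! ℕ.* n !) * (pos 1 / (P ℕ.* P)) {{prodFact²≢0 ps}}
    ≡⟨ cong₂ _*_ (ι-* (n !) (n !)) (sym (prodSeq-w ps)) ⟩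
  fact² n * prodSeq w ps ∎
  where P = prodFact ps

a≡fact²*E : ∀ N n → a N n ≡ fact² n * E N 0 n
a≡fact²*E N n = begin
  sumℚ (map (λ ps → multinomial n ps * multinomial n ps) (compositions N n))
    ≡⟨ sumℚ-cong (compositions N n) (multinomial² n) ⟩
  sumℚ (map (λ ps → fact² n * prodSeq w ps) (compositions N n))
    ≡⟨ sumℚ-*ˡ (fact² n) (prodSeq w) (compositions N n) ⟩
  fact² n * sumℚ (map (prodSeq w) (compositions N n))
    ≡⟨ cong (fact² n *_) (sumℚ-filter (λ ps → sumℕ ps ≡ᵇ n) (prodSeq w) (lists N (upTo (suc n)))) ⟩
  fact² n * sumℚ (map (λ ps → if sumℕ ps ≡ᵇ n then prodSeq w ps else 0ℚ) (lists N (upTo (suc n))))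
    ≡⟨ cong (fact² n *_) (trans (sumℚ-lists-convPow w N ℕₚ.≤-refl) (sym (E-zero≡convPow N n))) ⟩
  fact² n * E N 0 n ∎

-- The coefficients c

∧-swap : ∀ a b c → a ∧ (b ∧ c) ≡ b ∧ (a ∧ c)
∧-swap true  b c = refl
∧-swap false b c = sym (∧-zeroʳ b)

inS-suc : ∀ j y ys → inS j (suc y ∷ ys) ≡ (y <ᵇ j) ∧ inS (y ∸ 1) ys
inS-suc j y       []             = refl
inS-suc j y       (zero ∷ zs)    = sym (∧-zeroʳ (y <ᵇ j))
inS-suc j zero    (suc z ∷ zs)   = ∧-swap (allPos zs) (0 <ᵇ j) false
inS-suc j (suc y) (suc z ∷ zs)   = ∧-swap (allPos zs) (suc y <ᵇ j) _

module _ (N : ℕ) where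

  -- T j k n is n^-(N+1) c_k(n) with the constraint α₁ ≤ N weakened to α₁ ≤ j; the sum runs
  -- over α₁ = x + 1, after which the remaining sequence lies in S_{k-1}(α₁ - 2) at n - 1.
  T : ℕ → ℕ → ℕ → ℚ
  T j zero    n = 1ℚ
  T j (suc k) n = ∑[ x < j ] (factor N n 1 (suc x) * T (x ∸ 1) k (n ∸ 1))

  prodFactors-shift : ∀ n i αs → prodFactors N n (suc i) αs ≡ prodFactors N (n ∸ 1) i αs
  prodFactors-shift n i []       = refl
  prodFactors-shift n i (α ∷ αs) = cong₂ _*_ factor-shift (prodFactors-shift n (suc i) αs)
    where
    factor-shift : factor N n (suc i) α ≡ factor N (n ∸ 1) i α
    factor-shift = cong (λ z → (- (pos (α ℕ.* (suc N ∸ α)) / 1)) * powℚ (pos z / suc z) (α ∸ 1))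
                        (sym (ℕₚ.∸-+-assoc n 1 i))

  sumℚ-S≡T : ∀ k {j} n → j ≤ N →
    sumℚ (map (λ αs → if inS j αs then prodFactors N n 1 αs else 0ℚ) (lists k (upTo (suc N)))) ≡ T j k n
  sumℚ-S≡T zero    n j≤N = +-identityʳ 1ℚ
  sumℚ-S≡T (suc k) {j} n j≤N = begin
    sumℚ (map F (lists (suc k) L))
      ≡⟨ sumℚ-lists-suc k L F ⟩
    sumℚ (map (λ x → sumℚ (map (λ ys → F (x ∷ ys)) (lists k L))) L)
      ≡⟨ sumℚ-upTo (suc N) (λ x → sumℚ (map (λ ys → F (x ∷ ys)) (lists k L))) ⟩
    -- inS j (0 ∷ ys) reduces to false, so the term x = 0 vanishes.
    sumℚ (map (λ _ → 0ℚ) (lists k L)) + ∑[ y < N ] sumℚ (map (λ ys → F (suc y ∷ ys)) (lists k L))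
      ≡⟨ cong₂ _+_ (sumℚ-zero (lists k L)) (∑<-cong N fixed-head) ⟩
    0ℚ + ∑[ y < N ] (if y <ᵇ j then factor N n 1 (suc y) * T (y ∸ 1) k (n ∸ 1) else 0ℚ)
      ≡⟨ +-identityˡ _ ⟩
    ∑[ y < N ] (if y <ᵇ j then factor N n 1 (suc y) * T (y ∸ 1) k (n ∸ 1) else 0ℚ)
      ≡⟨ ∑<-<ᵇ (λ y → factor N n 1 (suc y) * T (y ∸ 1) k (n ∸ 1)) j≤N ⟩
    T j (suc k) n ∎
    where
    L = upTo (suc N)
    F : List ℕ → ℚ
    F αs = if inS j αs then prodFactors N n 1 αs else 0ℚ
    fixed-head : ∀ {y} → y < N → sumℚ (map (λ ys → F (suc y ∷ ys)) (lists k L)) ≡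
                 (if y <ᵇ j then factor N n 1 (suc y) * T (y ∸ 1) k (n ∸ 1) else 0ℚ)
    fixed-head {y} y<N = begin
      sumℚ (map (λ ys → F (suc y ∷ ys)) (lists k L))
        ≡⟨ sumℚ-cong (lists k L) (λ ys → cong₂ (λ b z → if b then factor N n 1 (suc y) * z else 0ℚ)
                                               (inS-suc j y ys) (prodFactors-shift n 1 ys)) ⟩
      sumℚ (map (λ ys → if (y <ᵇ j) ∧ inS (y ∸ 1) ys then factor N n 1 (suc y) * prodFactors N (n ∸ 1) 1 ys else 0ℚ) (lists k L))
        ≡⟨ sumℚ-if-∧ (y <ᵇ j) (inS (y ∸ 1)) (factor N n 1 (suc y)) (prodFactors N (n ∸ 1) 1) (lists k L) ⟩
      (if y <ᵇ j then factor N n 1 (suc y) * sumℚ (map (λ ys → if inS (y ∸ 1) ys then prodFactors N (n ∸ 1) 1 ys else 0ℚ) (lists k L)) else 0ℚ)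
        ≡⟨ cong (λ z → if y <ᵇ j then factor N n 1 (suc y) * z else 0ℚ)
                (sumℚ-S≡T k (n ∸ 1) (ℕₚ.≤-trans (ℕₚ.m∸n≤m y 1) (ℕₚ.<⇒≤ y<N))) ⟩
      (if y <ᵇ j then factor N n 1 (suc y) * T (y ∸ 1) k (n ∸ 1) else 0ℚ) ∎

  c≡ι[n^N+1]*T : ∀ k n → c N k n ≡ ι (n ^ suc N) * T N k n
  c≡ι[n^N+1]*T k n = cong (ι (n ^ suc N) *_)
    (trans (sumℚ-filter (inS N) (prodFactors N n 1) (lists k (upTo (suc N)))) (sumℚ-S≡T k n ℕₚ.≤-refl))

  R : ℕ → ℕ → ℕ → ℚ
  R j K n = ∑[ k < suc K ] (T j k n * a N (n ∸ k))

  R-zero : ∀ K n → R 0 K n ≡ a N n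
  R-zero K n = begin
    1ℚ * a N n + ∑[ k < K ] (0ℚ * a N (n ∸ suc k))
      ≡⟨ cong₂ _+_ (*-identityˡ (a N n)) (∑<-cong K (λ {k} _ → *-zeroˡ (a N (n ∸ suc k)))) ⟩
    a N n + ∑[ k < K ] 0ℚ
      ≡⟨ cong (a N n +_) (∑<-zero K) ⟩
    a N n + 0ℚ
      ≡⟨ +-identityʳ (a N n) ⟩
    a N n ∎

  R-suc : ∀ j K n → R (suc j) (suc K) n ≡ R j (suc K) n + factor N n 1 (suc j) * R (j ∸ 1) K (n ∸ 1)
  R-suc j K n = begin
    1ℚ * a N n + ∑[ k < suc K ] (T (suc j) (suc k) n * a N (n ∸ suc k))
      ≡⟨ cong (1ℚ * a N n +_) (∑<-cong (suc K) (λ {k} _ → split k)) ⟩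
    1ℚ * a N n + ∑[ k < suc K ] (T j (suc k) n * a N (n ∸ suc k) + f * (T (j ∸ 1) k (n ∸ 1) * a N (n ∸ 1 ∸ k)))
      ≡⟨ cong (1ℚ * a N n +_) (∑<-+ (suc K) (λ k → T j (suc k) n * a N (n ∸ suc k))
                                             (λ k → f * (T (j ∸ 1) k (n ∸ 1) * a N (n ∸ 1 ∸ k)))) ⟩
    1ℚ * a N n + (∑[ k < suc K ] (T j (suc k) n * a N (n ∸ suc k)) + ∑[ k < suc K ] (f * (T (j ∸ 1) k (n ∸ 1) * a N (n ∸ 1 ∸ k))))
      ≡⟨ cong (λ z → 1ℚ * a N n + (∑[ k < suc K ] (T j (suc k) n * a N (n ∸ suc k)) + z))
              (∑<-*ˡ (suc K) f (λ k → T (j ∸ 1) k (n ∸ 1) * a N (n ∸ 1 ∸ k))) ⟩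
    1ℚ * a N n + (∑[ k < suc K ] (T j (suc k) n * a N (n ∸ suc k)) + f * R (j ∸ 1) K (n ∸ 1))
      ≡⟨ +-assoc (1ℚ * a N n) _ _ ⟨
    R j (suc K) n + f * R (j ∸ 1) K (n ∸ 1) ∎
    where
    f = factor N n 1 (suc j)
    split : ∀ k → T (suc j) (suc k) n * a N (n ∸ suc k) ≡
                  T j (suc k) n * a N (n ∸ suc k) + f * (T (j ∸ 1) k (n ∸ 1) * a N (n ∸ 1 ∸ k))
    split k = begin
      T (suc j) (suc k) n * a N (n ∸ suc k)
        ≡⟨ cong (_* a N (n ∸ suc k)) (∑<-last j (λ x → factor N n 1 (suc x) * T (x ∸ 1) k (n ∸ 1))) ⟩
      (T j (suc k) n + f * T (j ∸ 1) k (n ∸ 1)) * a N (n ∸ suc k)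
        ≡⟨ solve 4 (λ t f t′ a → (t :+ f :* t′) :* a := t :* a :+ f :* (t′ :* a)) refl
                 (T j (suc k) n) f (T (j ∸ 1) k (n ∸ 1)) (a N (n ∸ suc k)) ⟩
      T j (suc k) n * a N (n ∸ suc k) + f * (T (j ∸ 1) k (n ∸ 1) * a N (n ∸ suc k))
        ≡⟨ cong (λ i → T j (suc k) n * a N (n ∸ suc k) + f * (T (j ∸ 1) k (n ∸ 1) * a N i))
                (ℕₚ.∸-+-assoc n 1 k) ⟨
      T j (suc k) n * a N (n ∸ suc k) + f * (T (j ∸ 1) k (n ∸ 1) * a N (n ∸ 1 ∸ k)) ∎

  ∑c*a≡ι[n^N+1]*R : ∀ K n → sumℚ (map (λ k → c N k n * a N (n ∸ k)) (upTo (suc K))) ≡ ι (n ^ suc N) * R N K n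
  ∑c*a≡ι[n^N+1]*R K n = begin
    sumℚ (map (λ k → c N k n * a N (n ∸ k)) (upTo (suc K)))
      ≡⟨ sumℚ-upTo (suc K) (λ k → c N k n * a N (n ∸ k)) ⟩
    ∑[ k < suc K ] (c N k n * a N (n ∸ k))
      ≡⟨ ∑<-cong (suc K) (λ {k} _ → trans (cong (_* a N (n ∸ k)) (c≡ι[n^N+1]*T k n)) (*-assoc (ι (n ^ suc N)) (T N k n) (a N (n ∸ k)))) ⟩
    ∑[ k < suc K ] (ι (n ^ suc N) * (T N k n * a N (n ∸ k)))
      ≡⟨ ∑<-*ˡ (suc K) (ι (n ^ suc N)) (λ k → T N k n * a N (n ∸ k)) ⟩
    ι (n ^ suc N) * R N K n ∎

  -- T (j ∸ 1) k vanishes for k > ⌊j/2⌋, so the bound on K only excludes truncating nonzero terms.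
  Invariant : ℕ → Set
  Invariant j = ∀ K → ⌊ j /2⌋ ≤ K → ∀ n → powℚ (ι n) j * R (j ∸ 1) K n ≡ ι (j !) * (fact² n * E N j n)

  invariant-0 : Invariant 0
  invariant-0 K _ n = begin
    1ℚ * R 0 K n              ≡⟨ *-identityˡ _ ⟩
    R 0 K n                   ≡⟨ R-zero K n ⟩
    a N n                     ≡⟨ a≡fact²*E N n ⟩
    fact² n * E N 0 n         ≡⟨ *-identityˡ _ ⟨
    1ℚ * (fact² n * E N 0 n)  ∎

  invariant-1 : Invariant 1
  invariant-1 K _ n = begin
    (ι n * 1ℚ) * R 0 K n              ≡⟨ cong ((ι n * 1ℚ) *_) (trans (R-zero K n) (a≡fact²*E N n)) ⟩
    (ι n * 1ℚ) * (fact² n * E N 0 n)  ≡⟨ solve 3 (λ x f e → (x :* con 1ℚ) :* (f :* e) := con 1ℚ :* (f :* (x :* e))) refl (ι n) (fact² n) (E N 0 n) ⟩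
    1ℚ * (fact² n * θ (E N 0) n)      ≡⟨ cong (λ z → 1ℚ * (fact² n * z)) θE₀≡E₁ ⟩
    1ℚ * (fact² n * E N 1 n)          ∎
    where
    θE₀≡E₁ : θ (E N 0) n ≡ E N 1 n
    θE₀≡E₁ = begin
      θ (E N 0) n                              ≡⟨ E-recurrence N 0 n ⟩
      ι 1 * E N 1 n + κ N 0 * shift 0ˢ n       ≡⟨ cong (λ z → ι 1 * E N 1 n + κ N 0 * z) (shift-0ˢ n) ⟩
      ι 1 * E N 1 n + κ N 0 * 0ℚ               ≡⟨ solve 2 (λ e k → con 1ℚ :* e :+ k :* con 0ℚ := e) refl (E N 1 n) (κ N 0) ⟩
      E N 1 n                                  ∎

  invariant-step : ∀ j → suc j ≤ N → Invariant (suc j) → Invariant j → Invariant (suc (suc j))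
  invariant-step j j<N inv₁ inv₀ zero    () n
  invariant-step j j<N inv₁ inv₀ (suc K) (s≤s ⌊j/2⌋≤K) zero = begin
    (0ℚ * powℚ 0ℚ (suc j)) * R (suc j) (suc K) 0      ≡⟨ cong (_* R (suc j) (suc K) 0) (*-zeroˡ (powℚ 0ℚ (suc j))) ⟩
    0ℚ * R (suc j) (suc K) 0                          ≡⟨ *-zeroˡ (R (suc j) (suc K) 0) ⟩
    0ℚ                                                ≡⟨ solve 2 (λ c f → con 0ℚ := c :* (f :* con 0ℚ)) refl (ι (suc (suc j) !)) (fact² 0) ⟩
    ι (suc (suc j) !) * (fact² 0 * 0ℚ)                ≡⟨ cong (λ z → ι (suc (suc j) !) * (fact² 0 * z)) (E-at-0 N (suc j)) ⟨
    ι (suc (suc j) !) * (fact² 0 * E N (suc (suc j)) 0) ∎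
  invariant-step j j<N inv₁ inv₀ (suc K) (s≤s ⌊j/2⌋≤K) (suc m) = begin
    powℚ x (suc (suc j)) * R (suc j) (suc K) (suc m)
      ≡⟨ cong (powℚ x (suc (suc j)) *_) (R-suc j K (suc m)) ⟩
    (x * (x * px)) * (Rj + ((- ι (suc j ℕ.* (N ∸ j))) * pr) * Rj₋₁)
      ≡⟨ cong (λ z → (x * (x * px)) * (Rj + ((- z) * pr) * Rj₋₁)) (ι-* (suc j) (N ∸ j)) ⟩
    (x * (x * px)) * (Rj + ((- (s₁ * d)) * pr) * Rj₋₁)
      ≡⟨ solve 7 (λ x px pr rj rj₋₁ s₁ d → (x :* (x :* px)) :* (rj :+ ((:- (s₁ :* d)) :* pr) :* rj₋₁)
                                       := x :* ((x :* px) :* rj) :- (s₁ :* d) :* ((x :* x) :* ((px :* pr) :* rj₋₁)))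
               refl x px pr Rj Rj₋₁ s₁ d ⟩
    x * ((x * px) * Rj) - (s₁ * d) * ((x * x) * ((px * pr) * Rj₋₁))
      ≡⟨ cong₂ (λ p q → x * p - (s₁ * d) * ((x * x) * q)) invariant-at-j+1 invariant-at-j ⟩
    x * ((s₁ * fj) * (((x * fm) * (x * fm)) * e₁)) - (s₁ * d) * ((x * x) * (fj * ((fm * fm) * e₀)))
      ≡⟨ solve 7 (λ x s₁ fj fm d e₁ e₀ → x :* ((s₁ :* fj) :* (((x :* fm) :* (x :* fm)) :* e₁)) :- (s₁ :* d) :* ((x :* x) :* (fj :* ((fm :* fm) :* e₀)))
                                      := ((s₁ :* fj) :* ((x :* fm) :* (x :* fm))) :* (x :* e₁ :- d :* e₀))
               refl x s₁ fj fm d e₁ e₀ ⟩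
    ((s₁ * fj) * ((x * fm) * (x * fm))) * (x * e₁ - d * e₀)
      ≡⟨ cong (((s₁ * fj) * ((x * fm) * (x * fm))) *_) three-term ⟩
    ((s₁ * fj) * ((x * fm) * (x * fm))) * (s₂ * e₂)
      ≡⟨ solve 6 (λ x s₁ fj fm s₂ e₂ → ((s₁ :* fj) :* ((x :* fm) :* (x :* fm))) :* (s₂ :* e₂)
                                   := (s₂ :* (s₁ :* fj)) :* (((x :* fm) :* (x :* fm)) :* e₂))
               refl x s₁ fj fm s₂ e₂ ⟩
    (s₂ * (s₁ * fj)) * (((x * fm) * (x * fm)) * e₂)
      ≡⟨ cong₂ (λ p q → p * (q * e₂)) (trans (ι-* (suc (suc j)) (suc j !)) (cong (s₂ *_) (ι-* (suc j) (j !))))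
                                       (fact²-suc m) ⟨
    ι (suc (suc j) !) * (fact² (suc m) * e₂) ∎
    where
    x  = ι (suc m)
    px = powℚ x j
    pr = powℚ (pos m / suc m) j
    Rj   = R j (suc K) (suc m)
    Rj₋₁ = R (j ∸ 1) K m
    s₁ = ι (suc j)
    s₂ = ι (suc (suc j))
    d  = ι (N ∸ j)
    fj = ι (j !)
    fm = ι (m !)
    e₀ = E N j m
    e₁ = E N (suc j) (suc m)
    e₂ = E N (suc (suc j)) (suc m)
    invariant-at-j+1 : (x * px) * Rj ≡ (s₁ * fj) * (((x * fm) * (x * fm)) * e₁)
    invariant-at-j+1 = trans (inv₁ (suc K) (ℕₚ.≤-trans (ℕₚ.⌊n/2⌋-mono (ℕₚ.n≤1+n (suc j))) (s≤s ⌊j/2⌋≤K)) (suc m))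
                             (cong₂ (λ p q → p * (q * e₁)) (ι-* (suc j) (j !)) (fact²-suc m))
    invariant-at-j : (px * pr) * Rj₋₁ ≡ fj * ((fm * fm) * e₀)
    invariant-at-j = trans (cong (_* Rj₋₁) (pow-ratio m j)) (inv₀ K ⌊j/2⌋≤K m)
    three-term : x * e₁ - d * e₀ ≡ s₂ * e₂
    three-term = trans (cong (_- d * e₀) (E-three-term N j m j<N))
                       (solve 2 (λ a b → (a :+ b) :- b := a) refl (s₂ * e₂) (d * e₀))

  invariant : ∀ j → j ≤ suc N → Invariant j
  invariant zero          _         = invariant-0
  invariant (suc zero)    _         = invariant-1
  invariant (suc (suc j)) (s≤s j<N) =
    invariant-step j j<N (invariant (suc j) (ℕₚ.m≤n⇒m≤1+n j<N)) (invariant j (ℕₚ.m<n⇒m≤1+n j<N))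

theorem1 : (N : ℕ) → 1 ≤ N → (n : ℕ) → 1 ≤ n → M N ≤ n →
    sumℚ (map (λ k → c N k n * a N (n ∸ k)) (upTo (suc (M N)))) ≡ 0ℚ
theorem1 N _ n _ _ = begin
  sumℚ (map (λ k → c N k n * a N (n ∸ k)) (upTo (suc (M N))))
    ≡⟨ ∑c*a≡ι[n^N+1]*R N (M N) n ⟩
  ι (n ^ suc N) * R N N (M N) n
    ≡⟨ cong (_* R N N (M N) n) (ι-^ n (suc N)) ⟩
  powℚ (ι n) (suc N) * R N N (M N) n
    ≡⟨ invariant N (suc N) ℕₚ.≤-refl (M N) ℕₚ.≤-refl n ⟩
  ι (suc N !) * (fact² n * E N (suc N) n)
    ≡⟨ cong (λ z → ι (suc N !) * (fact² n * z)) (E-vanish N (suc N) n ℕₚ.≤-refl) ⟩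
  ι (suc N !) * (fact² n * 0ℚ)
    ≡⟨ solve 2 (λ c f → c :* (f :* con 0ℚ) := con 0ℚ) refl (ι (suc N !)) (fact² n) ⟩
  0ℚ ∎
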